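{- Let $G$ and $H$ be finite graphs and let $D$ be a dominating set of $G\Box H$. If there exist minimum dominating sets $D_1$ and $D_2$ of $G$ such that for every $h\in V(H)$ we have $p_G(D\cap G_h)\subseteq D_i$ for some $i\in\{1,2\}$, then $|D|\geq \gamma(G)\gamma(H)$.
   Context: $\gamma(X)$ denotes the domination number of a graph $X$ (the minimum size of a dominating set); a minimum dominating set is a dominating set of size $\gamma$. $G\Box H$ is the Cartesian product of $G$ and $H$. For $h\in V(H)$, $G_h=\{(g,h)\mid g\in V(G)\}$. The projection $p_G:V(G\Box H)\to V(G)$ is $p_G(g,h)=g$. -}

module Defs where

open import Data.Nat using (ℕ; _*_; _≤_)
open import Data.Fin using (Fin; quotient; remainder; combine)
open import Data.Fin.Subset using (Subset; _∈_; _⊆_; ∣_∣)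
open import Data.Product using (Σ; ∃; _×_; _,_)
open import Data.Sum using (_⊎_; inj₁; inj₂)
open import Relation.Binary.PropositionalEquality using (_≡_) renaming (sym to ≡-sym)
open import Relation.Nullary using (¬_)

record Graph (n : ℕ) : Set₁ where
  field
    Adj    : Fin n → Fin n → Set
    adj-sym    : ∀ {u v} → Adj u v → Adj v u
    adj-irrefl : ∀ {u} → ¬ Adj u u
open Graph public

IsDominating : ∀ {n} → Graph n → Subset n → Set
IsDominating {n} X S = ∀ (v : Fin n) → v ∈ S ⊎ (Σ (Fin n) λ u → u ∈ S × Adj X u v)

IsMinDominating : ∀ {n} → Graph n → Subset n → Set
IsMinDominating {n} X S = IsDominating X S × (∀ (T : Subset n) → IsDominating X T → ∣ S ∣ ≤ ∣ T ∣)

IsDominationNumber : ∀ {n} → Graph n → ℕ → Set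
IsDominationNumber {n} X k =
  (Σ (Subset n) λ S → IsDominating X S × ∣ S ∣ ≡ k) × (∀ (T : Subset n) → IsDominating X T → k ≤ ∣ T ∣)

-- Cartesian product G □ H on Fin (n * m); vertex i corresponds to
-- (quotient {n} m i , remainder m i) ∈ V(G) × V(H), and combine g h is the pair (g , h).
_□_ : ∀ {n m} → Graph n → Graph m → Graph (n * m)
_□_ {n} {m} G H = record { Adj = A ; adj-sym = symP ; adj-irrefl = irr }
  where
  A : Fin (n * m) → Fin (n * m) → Set
  A i j = (quotient {n} m i ≡ quotient {n} m j × Adj H (remainder {n} m i) (remainder {n} m j))
        ⊎ (Adj G (quotient {n} m i) (quotient {n} m j) × remainder {n} m i ≡ remainder {n} m j)
  symP : ∀ {i j} → A i j → A j i
  symP (inj₁ (e , a)) = inj₁ (≡-sym e , adj-sym H a)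
  symP (inj₂ (a , e)) = inj₂ (adj-sym G a , ≡-sym e)
  irr : ∀ {i} → ¬ A i i
  irr (inj₁ (_ , a)) = adj-irrefl H a
  irr (inj₂ (a , _)) = adj-irrefl G a

ProjSliceSubset : ∀ {n m} → Subset (n * m) → Fin m → Subset n → Set
ProjSliceSubset {n} {m} D h S = ∀ (g : Fin n) → combine g h ∈ D → g ∈ S

module Submission where

-- Each vertex u of a minimum dominating set S has a private neighbour: a vertex
-- dominated by u and by no other vertex of S.  Call u ∈ D₁ and w ∈ D₂ compatible
-- if u has a private neighbour (w.r.t. D₁) lying in D₂ at most as w, and
-- symmetrically.  For compatible u, w pick u in every layer G_h with
-- p_G(D ∩ G_h) ⊆ D₁ and w in the other layers.  The layers whose picked vertex
-- lies in D dominate H: if layer h is not one of them, the private neighbour p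
-- of its picked vertex can only be dominated in G □ H by some (p , h′) ∈ D, and
-- then p is the picked vertex of layer h′.  Linking each vertex to its private
-- neighbour in the other set is a partial matching of compatible pairs, any two
-- unmatched vertices are compatible, and |D₁| = |D₂|; so there is a fractional
-- perfect matching between D₁ and D₂ on compatible pairs.  Averaging the bounds
-- γ(H) over it counts every element of D exactly once: |D| ≥ |D₁| γ(H).

open import Defs
open import Data.Nat using (ℕ; zero; suc; pred; NonZero; _+_; _*_; _≤_; z≤n; _≤?_)
open import Data.Nat.Properties
  using (+-*-semiring; ≤-trans; ≤-antisym; <⇒≱; m≤m+n; m≤n+m; +-mono-≤; *-monoʳ-≤; *-comm; *-assoc;
         *-zeroʳ; +-identityʳ; +-assoc; +-cancelʳ-≡; *-cancelˡ-≤; *-distribˡ-+; module ≤-Reasoning)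
open import Data.Bool using (Bool; true; false; if_then_else_)
open import Data.Fin using (Fin; zero; suc; combine; quotient; remainder; _↑ˡ_; _↑ʳ_)
open import Data.Fin.Properties using (_≟_; suc-injective; any?; ¬∀⟶∃¬; remQuot-combine; combine-remQuot)
open import Data.Fin.Subset using (Subset; ∣_∣; _∈_; _∉_; _-_; inside; outside)
open import Data.Fin.Subset.Properties using (_∈?_; x∈p⇒∣p-x∣<∣p∣; x∈p∧x≢y⇒x∈p-y)
open import Data.Product using (Σ; ∃; _×_; _,_; proj₁; proj₂)
open import Data.Sum using (_⊎_; inj₁; inj₂; [_,_]′; map₂) renaming (swap to ⊎-swap)
open import Data.Vec using (_∷_; []; tabulate)
open import Data.Vec.Properties using (lookup∘tabulate; lookup⇒[]=)
open import Function using (_∘_; const; flip)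
open import Relation.Binary.Definitions using (Decidable)
open import Relation.Binary.PropositionalEquality
open import Relation.Nullary using (¬_; Dec; yes; no; does; contradiction; ¬?; ¬¬-map)
open import Relation.Nullary.Decidable using (_×-dec_; _⊎-dec_; dec-true; dec-false; decidable-stable)
open import Relation.Nullary.Decidable.Core using (¬¬-excluded-middle)
open import Algebra.Properties.Semiring.Sum +-*-semiring
  using (sum; sum-syntax; sum-cong-≗; sum-replicate-zero; ∑-comm; ∑-distrib-+; *-distribˡ-sum; *-distribʳ-sum)

𝟙 : ∀ {p} {P : Set p} → Dec P → ℕ
𝟙 P? = if does P? then 1 else 0

module _ {p} {P : Set p} (P? : Dec P) where

  𝟙-yes : P → 𝟙 P? ≡ 1
  𝟙-yes x rewrite dec-true P? x = refl

  𝟙-no : ¬ P → 𝟙 P? ≡ 0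
  𝟙-no ¬x rewrite dec-false P? ¬x = refl

𝟙*𝟙 : ∀ {p q} {P : Set p} {Q : Set q} (P? : Dec P) (Q? : Dec Q) → 𝟙 P? * 𝟙 Q? ≡ 𝟙 (P? ×-dec Q?)
𝟙*𝟙 P? Q? with does P? | does Q?
... | true  | true  = refl
... | true  | false = refl
... | false | _     = refl

sum-mono-≤ : ∀ {n} {f g : Fin n → ℕ} → (∀ i → f i ≤ g i) → sum f ≤ sum g
sum-mono-≤ {zero}  f≤g = z≤n
sum-mono-≤ {suc n} f≤g = +-mono-≤ (f≤g zero) (sum-mono-≤ (f≤g ∘ suc))

≤-sum : ∀ {n} (f : Fin n → ℕ) i → f i ≤ sum f
≤-sum f zero    = m≤m+n _ _
≤-sum f (suc i) = ≤-trans (≤-sum (f ∘ suc) i) (m≤n+m _ _)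

sum-zero : ∀ {n} {f : Fin n → ℕ} → (∀ i → f i ≡ 0) → sum f ≡ 0
sum-zero {n} f≡0 = trans (sum-cong-≗ f≡0) (sum-replicate-zero n)

sum-single : ∀ {n} (f : Fin n → ℕ) i → (∀ j → j ≢ i → f j ≡ 0) → sum f ≡ f i
sum-single f zero    f≡0 = trans (cong (f zero +_) (sum-zero (λ j → f≡0 (suc j) λ ()))) (+-identityʳ _)
sum-single f (suc i) f≡0 =
  cong₂ _+_ (f≡0 zero λ ()) (sum-single (f ∘ suc) i (λ j j≢i → f≡0 (suc j) (j≢i ∘ suc-injective)))

sum-↑ : ∀ {a b} (f : Fin (a + b) → ℕ) → sum f ≡ sum (f ∘ (_↑ˡ b)) + sum (f ∘ (a ↑ʳ_))
sum-↑ {zero}      f = refl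
sum-↑ {suc a} {b} f = trans (cong (f zero +_) (sum-↑ {a} (f ∘ suc))) (sym (+-assoc (f zero) _ _))

sum-combine : ∀ {n m} (f : Fin (n * m) → ℕ) → sum f ≡ ∑[ g < n ] ∑[ h < m ] f (combine g h)
sum-combine {zero}      f = refl
sum-combine {suc n} {m} f = trans (sum-↑ {m} f) (cong (sum (f ∘ (_↑ˡ n * m)) +_) (sum-combine {n} (f ∘ (m ↑ʳ_))))

∣p∣≡∑𝟙∈ : ∀ {n} (p : Subset n) → ∣ p ∣ ≡ ∑[ i < n ] 𝟙 (i ∈? p)
∣p∣≡∑𝟙∈ []            = refl
∣p∣≡∑𝟙∈ (inside  ∷ p) = cong suc (∣p∣≡∑𝟙∈ p)
∣p∣≡∑𝟙∈ (outside ∷ p) = ∣p∣≡∑𝟙∈ p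

∣tabulate∣ : ∀ {n} (b : Fin n → Bool) → ∣ tabulate b ∣ ≡ ∑[ i < n ] (if b i then 1 else 0)
∣tabulate∣ {zero}  b = refl
∣tabulate∣ {suc n} b with b zero
... | true  = cong suc (∣tabulate∣ (b ∘ suc))
... | false = ∣tabulate∣ (b ∘ suc)

section : ∀ {n m} → Subset (n * m) → (Fin m → Fin n) → Subset m
section D φ = tabulate (λ h → does (combine (φ h) h ∈? D))

∈-section : ∀ {n m} {D : Subset (n * m)} (φ : Fin m → Fin n) {h} → combine (φ h) h ∈ D → h ∈ section D φ
∈-section {D = D} φ {h} φh∈D = lookup⇒[]= h _ (trans (lookup∘tabulate _ h) (dec-true (_ ∈? D) φh∈D))

∣section∣ : ∀ {n m} (D : Subset (n * m)) (φ : Fin m → Fin n) →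
            ∣ section D φ ∣ ≡ ∑[ h < m ] 𝟙 (combine (φ h) h ∈? D)
∣section∣ D φ = ∣tabulate∣ (λ h → does (combine (φ h) h ∈? D))

module _ {n} (G : Graph n) where

  Dominates : Fin n → Fin n → Set
  Dominates u v = u ≡ v ⊎ Adj G u v

  Dominated : Subset n → Fin n → Set
  Dominated S v = v ∈ S ⊎ Σ (Fin n) λ u → u ∈ S × Adj G u v

  dominates-sym : ∀ {u v} → Dominates u v → Dominates v u
  dominates-sym (inj₁ u≡v)  = inj₁ (sym u≡v)
  dominates-sym (inj₂ u~v) = inj₂ (adj-sym G u~v)

  dominated⇒dominator : ∀ {S v} → Dominated S v → ∃ λ u → u ∈ S × Dominates u v
  dominated⇒dominator (inj₁ v∈S)           = _ , v∈S , inj₁ refl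
  dominated⇒dominator (inj₂ (u , u∈S , u~v)) = u , u∈S , inj₂ u~v

  dominator⇒dominated : ∀ {S u v} → u ∈ S → Dominates u v → Dominated S v
  dominator⇒dominated u∈S (inj₁ refl) = inj₁ u∈S
  dominator⇒dominated u∈S (inj₂ u~v)  = inj₂ (_ , u∈S , u~v)

  IsPrivateNeighbour : Subset n → Fin n → Fin n → Set
  IsPrivateNeighbour S u p = Dominates u p × (∀ v → v ∈ S → Dominates v p → v ≡ u)

  PrivatelyAvoids : Subset n → Subset n → Fin n → Fin n → Set
  PrivatelyAvoids S T u w = ∃ λ p → IsPrivateNeighbour S u p × (p ∈ T → p ≡ w)

  Compatible : Subset n → Subset n → Fin n → Fin n → Set
  Compatible S₁ S₂ u w = PrivatelyAvoids S₁ S₂ u w × PrivatelyAvoids S₂ S₁ w u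

  private-self : ∀ {S u p} → IsPrivateNeighbour S u p → p ∈ S → p ≡ u
  private-self (_ , unique) p∈S = unique _ p∈S (inj₁ refl)

  minDominating-size : ∀ {S γ} → IsDominationNumber G γ → IsMinDominating G S → ∣ S ∣ ≡ γ
  minDominating-size ((T , T-dom , ∣T∣≡γ) , γ-min) (S-dom , S-min) =
    ≤-antisym (subst (_ ≤_) ∣T∣≡γ (S-min T T-dom)) (γ-min _ S-dom)

  module _ (adj? : Decidable (Adj G)) where

    dominated? : ∀ S v → Dec (Dominated S v)
    dominated? S v = v ∈? S ⊎-dec any? (λ u → u ∈? S ×-dec adj? u v)

    -- Removing u from a minimum dominating set S leaves some vertex p undominated.
    minDominating⇒privateNeighbour : ∀ {S u} → IsMinDominating G S → u ∈ S → ∃ (IsPrivateNeighbour S u)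
    minDominating⇒privateNeighbour {S} {u} (S-dom , S-min) u∈S = p , u-dominates-p , unique
      where
      undominated : ∃ λ p → ¬ Dominated (S - u) p
      undominated = ¬∀⟶∃¬ n _ (dominated? (S - u))
        (λ S-u-dom → <⇒≱ (x∈p⇒∣p-x∣<∣p∣ u∈S) (S-min (S - u) S-u-dom))

      p : Fin n
      p = proj₁ undominated

      unique : ∀ v → v ∈ S → Dominates v p → v ≡ u
      unique v v∈S v-dom-p with v ≟ u
      ... | yes v≡u = v≡u
      ... | no  v≢u = contradiction (dominator⇒dominated (x∈p∧x≢y⇒x∈p-y v∈S v≢u) v-dom-p) (proj₂ undominated)

      u-dominates-p : Dominates u p
      u-dominates-p with dominated⇒dominator (S-dom p)
      ... | v , v∈S , v-dom-p = subst (λ v → Dominates v p) (unique v v∈S v-dom-p) v-dom-p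

    privateNeighbour : ∀ {S} → IsMinDominating G S → Fin n → Fin n
    privateNeighbour {S} S-min u with u ∈? S
    ... | yes u∈S = proj₁ (minDominating⇒privateNeighbour S-min u∈S)
    ... | no  _   = u

    privateNeighbour-private : ∀ {S u} (S-min : IsMinDominating G S) → u ∈ S →
                               IsPrivateNeighbour S u (privateNeighbour S-min u)
    privateNeighbour-private {S} {u} S-min u∈S with u ∈? S
    ... | yes u∈S′ = proj₂ (minDominating⇒privateNeighbour S-min u∈S′)
    ... | no  u∉S  = contradiction u∈S u∉S

module _ {n m} (G : Graph n) (H : Graph m) where

  private
    quotient-combine : ∀ {g h} → quotient {n} m (combine g h) ≡ g
    quotient-combine {g} {h} = cong proj₁ (remQuot-combine {n} {m} g h)

    remainder-combine : ∀ {g h} → remainder {n} m (combine g h) ≡ h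
    remainder-combine {g} {h} = cong proj₂ (remQuot-combine {n} {m} g h)

  □-dominated : ∀ {D} → IsDominating (G □ H) D → ∀ g h →
                combine g h ∈ D
                ⊎ (∃ λ g′ → combine g′ h ∈ D × Adj G g′ g)
                ⊎ (∃ λ h′ → combine g h′ ∈ D × Adj H h′ h)
  □-dominated {D} D-dom g h with D-dom (combine g h)
  ... | inj₁ gh∈D = inj₁ gh∈D
  ... | inj₂ (j , j∈D , j~gh) = inj₂ (neighbour j~gh)
    where
    j₁ : Fin n
    j₁ = quotient {n} m j

    j₂ : Fin m
    j₂ = remainder {n} m j

    j∈D′ : combine j₁ j₂ ∈ D
    j∈D′ = subst (_∈ D) (sym (combine-remQuot {n} m j)) j∈D

    neighbour : Adj (G □ H) j (combine g h) →
                (∃ λ g′ → combine g′ h ∈ D × Adj G g′ g) ⊎ (∃ λ h′ → combine g h′ ∈ D × Adj H h′ h)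
    neighbour (inj₁ (j₁≡g , j₂~h)) =
      inj₂ (j₂ , subst (λ x → combine x j₂ ∈ D) (trans j₁≡g quotient-combine) j∈D′ ,
                 subst (Adj H j₂) remainder-combine j₂~h)
    neighbour (inj₂ (j₁~g , j₂≡h)) =
      inj₁ (j₁ , subst (λ y → combine j₁ y ∈ D) (trans j₂≡h remainder-combine) j∈D′ ,
                 subst (Adj G j₁) quotient-combine j₁~g)

  section-dominating : ∀ {D} → IsDominating (G □ H) D →
                       (S : Fin m → Subset n) → (∀ h → ProjSliceSubset D h (S h)) →
                       (φ : Fin m → Fin n) →
                       (∀ h → ∃ λ p → IsPrivateNeighbour G (S h) (φ h) p × (∀ h′ → p ∈ S h′ → p ≡ φ h′)) →
                       IsDominating H (section D φ)
  section-dominating {D} D-dom S D⊆S φ private-avoiding h with combine (φ h) h ∈? D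
  ... | yes φh∈D = inj₁ (∈-section φ φh∈D)
  ... | no  φh∉D with private-avoiding h
  ...   | p , (_ , unique) , p-avoids with □-dominated D-dom p h
  ...     | inj₁ ph∈D =
    contradiction (subst (λ x → combine x h ∈ D) (unique p (D⊆S h p ph∈D) (inj₁ refl)) ph∈D) φh∉D
  ...     | inj₂ (inj₁ (g′ , g′h∈D , g′~p)) =
    contradiction (subst (λ x → combine x h ∈ D) (unique g′ (D⊆S h g′ g′h∈D) (inj₂ g′~p)) g′h∈D) φh∉D
  ...     | inj₂ (inj₂ (h′ , ph′∈D , h′~h)) =
    inj₂ (h′ , ∈-section φ (subst (λ x → combine x h′ ∈ D) (p-avoids h′ (D⊆S h′ p ph′∈D)) ph′∈D) , h′~h)

-- A fractional perfect matching between A and B supported on Allowed pairs,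
-- with its weights multiplied by `scale` to make them natural numbers.
record FractionalMatching {n} (A B : Subset n) (Allowed : Fin n → Fin n → Set) : Set where
  field
    scale             : ℕ
    {{scale-nonZero}} : NonZero scale
    weight            : Fin n → Fin n → ℕ
    weight-allowed    : ∀ u w → weight u w ≡ 0 ⊎ Allowed u w
    row-sum           : ∀ u → ∑[ w < n ] weight u w ≡ scale * 𝟙 (u ∈? A)
    col-sum           : ∀ w → ∑[ u < n ] weight u w ≡ scale * 𝟙 (w ∈? B)

  transpose : FractionalMatching B A (flip Allowed)
  transpose = record
    { scale          = scale
    ; weight         = flip weight
    ; weight-allowed = flip weight-allowed
    ; row-sum        = col-sum
    ; col-sum        = row-sum
    }

  weaken : ∀ {Allowed′ : Fin n → Fin n → Set} →
           (∀ {u w} → Allowed u w → Allowed′ u w) → FractionalMatching A B Allowed′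
  weaken allowed = record
    { scale          = scale
    ; weight         = weight
    ; weight-allowed = λ u w → map₂ allowed (weight-allowed u w)
    ; row-sum        = row-sum
    ; col-sum        = col-sum
    }

  open ≡-Reasoning

  ∑-weighted-rows : (f : Fin n → ℕ) → (∀ u → u ∉ A → f u ≡ 0) →
                    ∑[ u < n ] ∑[ w < n ] (weight u w * f u) ≡ scale * sum f
  ∑-weighted-rows f f-vanishes = begin
    ∑[ u < n ] ∑[ w < n ] (weight u w * f u)   ≡⟨ sum-cong-≗ (λ u → *-distribʳ-sum (f u) (weight u)) ⟨
    ∑[ u < n ] (∑[ w < n ] weight u w * f u)   ≡⟨ sum-cong-≗ (λ u → cong (_* f u) (row-sum u)) ⟩
    ∑[ u < n ] (scale * 𝟙 (u ∈? A) * f u)     ≡⟨ sum-cong-≗ (λ u → trans (*-assoc scale _ _) (cong (scale *_) (restrict u))) ⟩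
    ∑[ u < n ] (scale * f u)                   ≡⟨ *-distribˡ-sum scale f ⟨
    scale * sum f                              ∎
    where
    restrict : ∀ u → 𝟙 (u ∈? A) * f u ≡ f u
    restrict u with u ∈? A
    ... | yes _   = +-identityʳ (f u)
    ... | no  u∉A = sym (f-vanishes u u∉A)

  ∑-weights : ∑[ u < n ] ∑[ w < n ] weight u w ≡ scale * ∣ A ∣
  ∑-weights = begin
    ∑[ u < n ] ∑[ w < n ] weight u w ≡⟨ sum-cong-≗ row-sum ⟩
    ∑[ u < n ] (scale * 𝟙 (u ∈? A)) ≡⟨ *-distribˡ-sum scale (λ u → 𝟙 (u ∈? A)) ⟨
    scale * ∑[ u < n ] 𝟙 (u ∈? A)   ≡⟨ cong (scale *_) (∣p∣≡∑𝟙∈ A) ⟨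
    scale * ∣ A ∣                   ∎

∑-weighted-cols : ∀ {n} {A B : Subset n} {Allowed} (M : FractionalMatching A B Allowed) →
                  let open FractionalMatching M in
                  (f : Fin n → ℕ) → (∀ w → w ∉ B → f w ≡ 0) →
                  ∑[ u < n ] ∑[ w < n ] (weight u w * f w) ≡ scale * sum f
∑-weighted-cols M f f-vanishes =
  trans (∑-comm (λ u w → weight u w * f w)) (FractionalMatching.∑-weighted-rows transpose f f-vanishes)
  where open FractionalMatching M

module Unmatched {n} (A : Subset n) {R : Fin n → Fin n → Set} (R? : Decidable R)
                 (R⊆A : ∀ {u w} → R u w → u ∈ A)
                 (R-functional : ∀ {u w w′} → R u w → R u w′ → w ≡ w′) where

  Unmatched : Fin n → Set
  Unmatched u = u ∈ A × ¬ ∃ (R u)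

  unmatched? : ∀ u → Dec (Unmatched u)
  unmatched? u = u ∈? A ×-dec ¬? (any? (R? u))

  degree : Fin n → ℕ
  degree u = ∑[ w < n ] 𝟙 (R? u w)

  degree-matched : ∀ {u w} → R u w → degree u ≡ 1
  degree-matched {u} {w} uRw =
    trans (sum-single _ w (λ w′ w′≢w → 𝟙-no (R? u w′) (λ uRw′ → w′≢w (R-functional uRw′ uRw))))
          (𝟙-yes (R? u w) uRw)

  degree-unmatched : ∀ {u} → ¬ ∃ (R u) → degree u ≡ 0
  degree-unmatched {u} ¬uR = sum-zero (λ w → 𝟙-no (R? u w) (λ uRw → ¬uR (w , uRw)))

  𝟙∈≡𝟙unmatched+degree : ∀ u → 𝟙 (u ∈? A) ≡ 𝟙 (unmatched? u) + degree u
  𝟙∈≡𝟙unmatched+degree u = split (u ∈? A) (any? (R? u))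
    where
    split : Dec (u ∈ A) → Dec (∃ (R u)) → 𝟙 (u ∈? A) ≡ 𝟙 (unmatched? u) + degree u
    split (no u∉A) _ = trans (𝟙-no (u ∈? A) u∉A)
      (sym (cong₂ _+_ (𝟙-no (unmatched? u) (u∉A ∘ proj₁)) (degree-unmatched (u∉A ∘ R⊆A ∘ proj₂))))
    split (yes u∈A) (yes (w , uRw)) = trans (𝟙-yes (u ∈? A) u∈A)
      (sym (cong₂ _+_ (𝟙-no (unmatched? u) (λ (_ , ¬uR) → ¬uR (w , uRw))) (degree-matched uRw)))
    split (yes u∈A) (no ¬uR) = trans (𝟙-yes (u ∈? A) u∈A)
      (sym (cong₂ _+_ (𝟙-yes (unmatched? u) (u∈A , ¬uR)) (degree-unmatched ¬uR)))

  unmatchedCount : ℕ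
  unmatchedCount = ∑[ u < n ] 𝟙 (unmatched? u)

  ∣A∣≡unmatched+matched : ∣ A ∣ ≡ unmatchedCount + ∑[ u < n ] degree u
  ∣A∣≡unmatched+matched =
    trans (∣p∣≡∑𝟙∈ A) (trans (sum-cong-≗ 𝟙∈≡𝟙unmatched+degree) (∑-distrib-+ _ degree))

m≤n⇒n*m≡suc[pred[n]]*m : ∀ {m} n → m ≤ n → n * m ≡ suc (pred n) * m
m≤n⇒n*m≡suc[pred[n]]*m zero    z≤n = refl
m≤n⇒n*m≡suc[pred[n]]*m (suc n) _   = refl

-- Weight `scale` on each matched pair and weight 1 on each pair of unmatched
-- vertices; there are equally many unmatched vertices on both sides, so their
-- number can serve as `scale` (unless it is 0).
module _ {n} {A B : Subset n} {R : Fin n → Fin n → Set} (R? : Decidable R)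
         (R⊆A×B : ∀ {u w} → R u w → u ∈ A × w ∈ B)
         (R-functional : ∀ {u w w′} → R u w → R u w′ → w ≡ w′)
         (R-injective : ∀ {u u′ w} → R u w → R u′ w → u ≡ u′)
         (∣A∣≡∣B∣ : ∣ A ∣ ≡ ∣ B ∣) where

  private
    module Left  = Unmatched A R? (proj₁ ∘ R⊆A×B) R-functional
    module Right = Unmatched B (flip R?) (proj₂ ∘ R⊆A×B) R-injective

    ρ : ℕ
    ρ = Left.unmatchedCount

    unmatched-balanced : ρ ≡ Right.unmatchedCount
    unmatched-balanced = +-cancelʳ-≡ _ _ _ (begin
      ρ + ∑[ u < n ] Left.degree u                     ≡⟨ Left.∣A∣≡unmatched+matched ⟨
      ∣ A ∣                                            ≡⟨ ∣A∣≡∣B∣ ⟩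
      ∣ B ∣                                            ≡⟨ Right.∣A∣≡unmatched+matched ⟩
      Right.unmatchedCount + ∑[ w < n ] Right.degree w
        ≡⟨ cong (Right.unmatchedCount +_) (∑-comm (λ u w → 𝟙 (R? u w))) ⟨
      Right.unmatchedCount + ∑[ u < n ] Left.degree u  ∎)
      where open ≡-Reasoning

    scale : ℕ
    scale = suc (pred ρ)

    unmatchedˡ unmatchedʳ : Fin n → ℕ
    unmatchedˡ u = 𝟙 (Left.unmatched? u)
    unmatchedʳ w = 𝟙 (Right.unmatched? w)

    ρ*≡scale* : ∀ {x} → x ≤ ρ → ρ * x ≡ scale * x
    ρ*≡scale* = m≤n⇒n*m≡suc[pred[n]]*m ρ

    unmatchedˡ≤ρ : ∀ u → unmatchedˡ u ≤ ρ
    unmatchedˡ≤ρ = ≤-sum unmatchedˡ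

    unmatchedʳ≤ρ : ∀ w → unmatchedʳ w ≤ ρ
    unmatchedʳ≤ρ w = subst (_ ≤_) (sym unmatched-balanced) (≤-sum unmatchedʳ w)

    weight : Fin n → Fin n → ℕ
    weight u w = unmatchedˡ u * unmatchedʳ w + scale * 𝟙 (R? u w)

    weight-allowed : ∀ u w → weight u w ≡ 0 ⊎ (R u w ⊎ Left.Unmatched u × Right.Unmatched w)
    weight-allowed u w with R? u w | Left.unmatched? u ×-dec Right.unmatched? w
    ... | yes uRw | _                 = inj₂ (inj₁ uRw)
    ... | no _    | yes both-unmatched = inj₂ (inj₂ both-unmatched)
    ... | no _    | no ¬both-unmatched = inj₁ (cong₂ _+_
      (trans (𝟙*𝟙 (Left.unmatched? u) (Right.unmatched? w)) (𝟙-no (Left.unmatched? u ×-dec Right.unmatched? w) ¬both-unmatched))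
      (*-zeroʳ scale))

    open ≡-Reasoning

    row-sum : ∀ u → ∑[ w < n ] weight u w ≡ scale * 𝟙 (u ∈? A)
    row-sum u = begin
      ∑[ w < n ] weight u w
        ≡⟨ ∑-distrib-+ (λ w → x * unmatchedʳ w) (λ w → scale * 𝟙 (R? u w)) ⟩
      ∑[ w < n ] (x * unmatchedʳ w) + ∑[ w < n ] (scale * 𝟙 (R? u w))
        ≡⟨ cong₂ _+_ (*-distribˡ-sum x unmatchedʳ) (*-distribˡ-sum scale (𝟙 ∘ R? u)) ⟨
      x * Right.unmatchedCount + scale * Left.degree u
        ≡⟨ cong (λ k → x * k + scale * Left.degree u) unmatched-balanced ⟨
      x * ρ + scale * Left.degree u
        ≡⟨ cong (_+ scale * Left.degree u) (trans (*-comm x ρ) (ρ*≡scale* (unmatchedˡ≤ρ u))) ⟩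
      scale * x + scale * Left.degree u
        ≡⟨ *-distribˡ-+ scale x (Left.degree u) ⟨
      scale * (x + Left.degree u)
        ≡⟨ cong (scale *_) (Left.𝟙∈≡𝟙unmatched+degree u) ⟨
      scale * 𝟙 (u ∈? A)
        ∎
      where x = unmatchedˡ u

    col-sum : ∀ w → ∑[ u < n ] weight u w ≡ scale * 𝟙 (w ∈? B)
    col-sum w = begin
      ∑[ u < n ] weight u w
        ≡⟨ ∑-distrib-+ (λ u → unmatchedˡ u * y) (λ u → scale * 𝟙 (R? u w)) ⟩
      ∑[ u < n ] (unmatchedˡ u * y) + ∑[ u < n ] (scale * 𝟙 (R? u w))
        ≡⟨ cong₂ _+_ (*-distribʳ-sum y unmatchedˡ) (*-distribˡ-sum scale (λ u → 𝟙 (R? u w))) ⟨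
      ρ * y + scale * Right.degree w
        ≡⟨ cong (_+ scale * Right.degree w) (ρ*≡scale* (unmatchedʳ≤ρ w)) ⟩
      scale * y + scale * Right.degree w
        ≡⟨ *-distribˡ-+ scale y (Right.degree w) ⟨
      scale * (y + Right.degree w)
        ≡⟨ cong (scale *_) (Right.𝟙∈≡𝟙unmatched+degree w) ⟨
      scale * 𝟙 (w ∈? B)
        ∎
      where y = unmatchedʳ w

  partial⇒fractionalMatching :
    FractionalMatching A B (λ u w → R u w ⊎ Left.Unmatched u × Right.Unmatched w)
  partial⇒fractionalMatching = record
    { scale          = scale
    ; weight         = weight
    ; weight-allowed = weight-allowed
    ; row-sum        = row-sum
    ; col-sum        = col-sum
    }

module PrivateLinks {n} (G : Graph n) (adj? : Decidable (Adj G)) {S₁ S₂ : Subset n}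
                    (S₁-min : IsMinDominating G S₁) (S₂-min : IsMinDominating G S₂) where

  p₁ p₂ : Fin n → Fin n
  p₁ = privateNeighbour G adj? S₁-min
  p₂ = privateNeighbour G adj? S₂-min

  Linked : Fin n → Fin n → Set
  Linked u w = (u ∈ S₁ × w ∈ S₂) × (w ≡ p₁ u ⊎ u ≡ p₂ w)

  linked? : Decidable Linked
  linked? u w = (u ∈? S₁ ×-dec w ∈? S₂) ×-dec (w ≟ p₁ u ⊎-dec u ≟ p₂ w)

  private
    p₁-private : ∀ {u} → u ∈ S₁ → IsPrivateNeighbour G S₁ u (p₁ u)
    p₁-private = privateNeighbour-private G adj? S₁-min

    p₂-private : ∀ {w} → w ∈ S₂ → IsPrivateNeighbour G S₂ w (p₂ w)
    p₂-private = privateNeighbour-private G adj? S₂-min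

    p₂-unique : ∀ {v u w} → v ∈ S₂ → Dominates G v u → u ≡ p₂ w → w ∈ S₂ → v ≡ w
    p₂-unique v∈S₂ v-dom-u refl w∈S₂ = proj₂ (p₂-private w∈S₂) _ v∈S₂ v-dom-u

  linked-avoids : ∀ {u w} → Linked u w → p₁ u ∈ S₂ → p₁ u ≡ w
  linked-avoids ((u∈S₁ , w∈S₂) , inj₁ w≡p₁u) _ = sym w≡p₁u
  linked-avoids ((u∈S₁ , w∈S₂) , inj₂ u≡p₂w) p₁u∈S₂ =
    p₂-unique p₁u∈S₂ (dominates-sym G (proj₁ (p₁-private u∈S₁))) u≡p₂w w∈S₂

  linked-functional : ∀ {u w w′} → Linked u w → Linked u w′ → w ≡ w′
  linked-functional l@(_ , inj₁ refl) l′ = linked-avoids l′ (proj₂ (proj₁ l))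
  linked-functional l l′@(_ , inj₁ refl) = sym (linked-avoids l (proj₂ (proj₁ l′)))
  linked-functional ((_ , w∈S₂) , inj₂ refl) ((_ , w′∈S₂) , inj₂ u≡p₂w′) =
    p₂-unique w∈S₂ (proj₁ (p₂-private w∈S₂)) u≡p₂w′ w′∈S₂

  linked⇒privatelyAvoids : ∀ {u w} → Linked u w → PrivatelyAvoids G S₁ S₂ u w
  linked⇒privatelyAvoids {u} l = p₁ u , p₁-private (proj₁ (proj₁ l)) , linked-avoids l

  unlinked⇒privatelyAvoids : ∀ {u w} → u ∈ S₁ → ¬ ∃ (Linked u) → PrivatelyAvoids G S₁ S₂ u w
  unlinked⇒privatelyAvoids {u} u∈S₁ unlinked =
    p₁ u , p₁-private u∈S₁ , λ p₁u∈S₂ → contradiction (p₁ u , (u∈S₁ , p₁u∈S₂) , inj₁ refl) unlinked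

compatibleMatching : ∀ {n} (G : Graph n) → Decidable (Adj G) →
                     ∀ {S₁ S₂} → IsMinDominating G S₁ → IsMinDominating G S₂ → ∣ S₁ ∣ ≡ ∣ S₂ ∣ →
                     FractionalMatching S₁ S₂ (Compatible G S₁ S₂)
compatibleMatching G adj? {S₁} {S₂} S₁-min S₂-min ∣S₁∣≡∣S₂∣ =
  FractionalMatching.weaken
    (partial⇒fractionalMatching L₁₂.linked? proj₁ L₁₂.linked-functional linked-injective ∣S₁∣≡∣S₂∣)
    compatible
  where
  module L₁₂ = PrivateLinks G adj? S₁-min S₂-min
  module L₂₁ = PrivateLinks G adj? S₂-min S₁-min

  swap₁₂ : ∀ {u w} → L₁₂.Linked u w → L₂₁.Linked w u
  swap₁₂ ((u∈S₁ , w∈S₂) , link) = (w∈S₂ , u∈S₁) , ⊎-swap link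

  swap₂₁ : ∀ {u w} → L₂₁.Linked w u → L₁₂.Linked u w
  swap₂₁ ((w∈S₂ , u∈S₁) , link) = (u∈S₁ , w∈S₂) , ⊎-swap link

  linked-injective : ∀ {u u′ w} → L₁₂.Linked u w → L₁₂.Linked u′ w → u ≡ u′
  linked-injective l l′ = L₂₁.linked-functional (swap₁₂ l) (swap₁₂ l′)

  compatible : ∀ {u w} →
               L₁₂.Linked u w ⊎ (u ∈ S₁ × ¬ ∃ (L₁₂.Linked u)) × (w ∈ S₂ × ¬ ∃ λ u → L₁₂.Linked u w) →
               Compatible G S₁ S₂ u w
  compatible (inj₁ l) = L₁₂.linked⇒privatelyAvoids l , L₂₁.linked⇒privatelyAvoids (swap₁₂ l)
  compatible (inj₂ ((u∈S₁ , u-unlinked) , (w∈S₂ , w-unlinked))) =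
    L₁₂.unlinked⇒privatelyAvoids u∈S₁ u-unlinked ,
    L₂₁.unlinked⇒privatelyAvoids w∈S₂ (λ (u , l) → w-unlinked (u , swap₂₁ l))

module Layers {n m} (D : Subset (n * m)) {D₁ D₂ : Subset n}
              (side : ∀ h → ProjSliceSubset D h D₁ ⊎ ProjSliceSubset D h D₂) where

  layer : Fin m → Subset n
  layer h = [ const D₁ , const D₂ ]′ (side h)

  pick : Fin n → Fin n → Fin m → Fin n
  pick u w h = [ const u , const w ]′ (side h)

  D⊆layer : ∀ h → ProjSliceSubset D h (layer h)
  D⊆layer h with side h
  ... | inj₁ D⊆D₁ = D⊆D₁
  ... | inj₂ D⊆D₂ = D⊆D₂

  compatible⇒section-dominating : ∀ {G : Graph n} {H : Graph m} → IsDominating (G □ H) D →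
                                  ∀ {u w} → Compatible G D₁ D₂ u w → IsDominating H (section D (pick u w))
  compatible⇒section-dominating {G} {H} D-dom {u} {w} ((p , p-private , p-avoids) , (q , q-private , q-avoids)) =
    section-dominating G H D-dom layer D⊆layer (pick u w) private-avoiding
    where
    avoids-layers : ∀ {x} → (x ∈ D₁ → x ≡ u) → (x ∈ D₂ → x ≡ w) → ∀ h′ → x ∈ layer h′ → x ≡ pick u w h′
    avoids-layers x₁ x₂ h′ with side h′
    ... | inj₁ _ = x₁
    ... | inj₂ _ = x₂

    private-avoiding : ∀ h → ∃ λ x → IsPrivateNeighbour G (layer h) (pick u w h) x ×
                                      (∀ h′ → x ∈ layer h′ → x ≡ pick u w h′)
    private-avoiding h with side h
    ... | inj₁ _ = p , p-private , avoids-layers (private-self G p-private) p-avoids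
    ... | inj₂ _ = q , q-private , avoids-layers q-avoids (private-self G q-private)

  χ : Fin n → Fin m → ℕ
  χ g h = 𝟙 (combine g h ∈? D)

  outside-vanishes : ∀ {S h} → ProjSliceSubset D h S → ∀ g → g ∉ S → χ g h ≡ 0
  outside-vanishes {h = h} D⊆S g g∉S = 𝟙-no (combine g h ∈? D) (g∉S ∘ D⊆S g)

  module _ {Allowed} (M : FractionalMatching D₁ D₂ Allowed) where
    open FractionalMatching M
    open ≡-Reasoning

    layer-count : ∀ h → ∑[ u < n ] ∑[ w < n ] (weight u w * χ (pick u w h) h) ≡ scale * ∑[ g < n ] χ g h
    layer-count h with side h
    ... | inj₁ D⊆D₁ = ∑-weighted-rows (λ g → χ g h) (outside-vanishes D⊆D₁)
    ... | inj₂ D⊆D₂ = ∑-weighted-cols M (λ g → χ g h) (outside-vanishes D⊆D₂)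

    double-count : scale * ∣ D ∣ ≡ ∑[ u < n ] ∑[ w < n ] (weight u w * ∣ section D (pick u w) ∣)
    double-count = begin
      scale * ∣ D ∣
        ≡⟨ cong (scale *_) (trans (∣p∣≡∑𝟙∈ D) (sum-combine {n} {m} (λ i → 𝟙 (i ∈? D)))) ⟩
      scale * ∑[ g < n ] ∑[ h < m ] χ g h
        ≡⟨ cong (scale *_) (∑-comm χ) ⟩
      scale * ∑[ h < m ] ∑[ g < n ] χ g h
        ≡⟨ *-distribˡ-sum scale (λ h → ∑[ g < n ] χ g h) ⟩
      ∑[ h < m ] (scale * ∑[ g < n ] χ g h)
        ≡⟨ sum-cong-≗ layer-count ⟨
      ∑[ h < m ] ∑[ u < n ] ∑[ w < n ] (weight u w * χ (pick u w h) h)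
        ≡⟨ ∑-comm (λ h u → ∑[ w < n ] (weight u w * χ (pick u w h) h)) ⟩
      ∑[ u < n ] ∑[ h < m ] ∑[ w < n ] (weight u w * χ (pick u w h) h)
        ≡⟨ sum-cong-≗ (λ u → ∑-comm (λ h w → weight u w * χ (pick u w h) h)) ⟩
      ∑[ u < n ] ∑[ w < n ] ∑[ h < m ] (weight u w * χ (pick u w h) h)
        ≡⟨ sum-cong-≗ (λ u → sum-cong-≗ (λ w → *-distribˡ-sum (weight u w) (λ h → χ (pick u w h) h))) ⟨
      ∑[ u < n ] ∑[ w < n ] (weight u w * ∑[ h < m ] χ (pick u w h) h)
        ≡⟨ sum-cong-≗ (λ u → sum-cong-≗ (λ w → cong (weight u w *_) (∣section∣ D (pick u w)))) ⟨
      ∑[ u < n ] ∑[ w < n ] (weight u w * ∣ section D (pick u w) ∣)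
        ∎

∣D∣-lowerBound : ∀ {n m} (G : Graph n) (H : Graph m) → Decidable (Adj G) →
                 ∀ {D : Subset (n * m)} → IsDominating (G □ H) D →
                 ∀ {D₁ D₂} → IsMinDominating G D₁ → IsMinDominating G D₂ →
                 (∀ h → ProjSliceSubset D h D₁ ⊎ ProjSliceSubset D h D₂) →
                 ∀ {γG γH} → IsDominationNumber G γG → IsDominationNumber H γH →
                 γG * γH ≤ ∣ D ∣
∣D∣-lowerBound {n} {m} G H adj? {D} D-dom {D₁} {D₂} D₁-min D₂-min side {γG} {γH} γG-def γH-def =
  *-cancelˡ-≤ scale (begin
    scale * (γG * γH)                            ≡⟨ *-assoc scale γG γH ⟨
    scale * γG * γH                              ≡⟨ cong (λ k → scale * k * γH) ∣D₁∣≡γG ⟨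
    scale * ∣ D₁ ∣ * γH                          ≡⟨ cong (_* γH) ∑-weights ⟨
    (∑[ u < n ] ∑[ w < n ] weight u w) * γH      ≡⟨ *-distribʳ-sum γH (λ u → ∑[ w < n ] weight u w) ⟩
    ∑[ u < n ] ((∑[ w < n ] weight u w) * γH)    ≡⟨ sum-cong-≗ (λ u → *-distribʳ-sum γH (weight u)) ⟩
    ∑[ u < n ] ∑[ w < n ] (weight u w * γH)      ≤⟨ sum-mono-≤ (λ u → sum-mono-≤ (weighted-bound u)) ⟩
    ∑[ u < n ] ∑[ w < n ] (weight u w * ∣ section D (pick u w) ∣) ≡⟨ double-count M ⟨
    scale * ∣ D ∣                                ∎)
  where
  open Layers D side
  open ≤-Reasoning

  ∣D₁∣≡γG : ∣ D₁ ∣ ≡ γG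
  ∣D₁∣≡γG = minDominating-size G γG-def D₁-min

  ∣D₂∣≡γG : ∣ D₂ ∣ ≡ γG
  ∣D₂∣≡γG = minDominating-size G γG-def D₂-min

  M : FractionalMatching D₁ D₂ (Compatible G D₁ D₂)
  M = compatibleMatching G adj? D₁-min D₂-min (trans ∣D₁∣≡γG (sym ∣D₂∣≡γG))
  open FractionalMatching M

  weighted-bound : ∀ u w → weight u w * γH ≤ weight u w * ∣ section D (pick u w) ∣
  weighted-bound u w with weight-allowed u w
  ... | inj₁ weight≡0 rewrite weight≡0 = z≤n
  ... | inj₂ compatible =
    *-monoʳ-≤ (weight u w) (proj₂ γH-def _ (compatible⇒section-dominating {G} {H} D-dom compatible))

¬¬-∀ : ∀ {n} {P : Fin n → Set} → (∀ i → ¬ ¬ P i) → ¬ ¬ (∀ i → P i)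
¬¬-∀ {zero}  ¬¬P ¬∀P = ¬∀P λ ()
¬¬-∀ {suc n} ¬¬P ¬∀P =
  ¬¬P zero λ P₀ → ¬¬-∀ (¬¬P ∘ suc) λ P₊ → ¬∀P λ { zero → P₀ ; (suc i) → P₊ i }

¬¬-decidable : ∀ {n} (R : Fin n → Fin n → Set) → ¬ ¬ Decidable R
¬¬-decidable R = ¬¬-∀ λ u → ¬¬-∀ λ v → ¬¬-excluded-middle

-- Adjacency in G need not be decidable, but the conclusion is a decidable
-- proposition and so may be proved assuming that it is.
corollary3 : ∀ {n m} (G : Graph n) (H : Graph m) (D : Subset (n * m))
    → IsDominating (G □ H) D
    → ∀ (D₁ D₂ : Subset n) → IsMinDominating G D₁ → IsMinDominating G D₂
    → (∀ (h : Fin m) → ProjSliceSubset D h D₁ ⊎ ProjSliceSubset D h D₂)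
    → ∀ (γG γH : ℕ) → IsDominationNumber G γG → IsDominationNumber H γH
    → γG * γH ≤ ∣ D ∣
corollary3 G H D D-dom D₁ D₂ D₁-min D₂-min side γG γH γG-def γH-def =
  decidable-stable (γG * γH ≤? ∣ D ∣)
    (¬¬-map (λ adj? → ∣D∣-lowerBound G H adj? D-dom D₁-min D₂-min side γG-def γH-def) (¬¬-decidable (Adj G)))
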